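{- Let $(a_n)_{n\ge1}$ be a sequence of positive integers, $n\ge1$, and let $x_0,x_n$ be integers with $2^{b_n}x_n-3^nx_0=B_n$, $1\le x_0<2^{b_n}$, $1\le x_n<3^n$ and $3\nmid x_0$. Define $x_k=\frac{3x_{k-1}+1}{2^{a_k}}$ for $1\le k\le n-1$, and suppose $x_0,\dots,x_{n-1}$ are distinct integers. Then $x_0>\frac{B_n}{3^n(1.5\,n^{1/9}-1)}$.
   Context: For a sequence $(a_n)_{n\ge1}$ of positive integers: $b_0=0$, $b_n=\sum_{i=1}^n a_i$, and $B_n=\sum_{i=0}^{n-1}3^{n-1-i}2^{b_i}$. -}

module Defs where

open import Data.Nat using (ℕ; zero; suc; _+_; _*_; _∸_; _^_)

sumBelow : ℕ → (ℕ → ℕ) → ℕ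
sumBelow zero    f = 0
sumBelow (suc n) f = sumBelow n f + f n

-- b_0 = 0, b_n = a_1 + ... + a_n   (a 0 is unused)
b : (ℕ → ℕ) → ℕ → ℕ
b a zero    = 0
b a (suc n) = b a n + a (suc n)

B : (ℕ → ℕ) → ℕ → ℕ
B a n = sumBelow n (λ i → 3 ^ (n ∸ 1 ∸ i) * 2 ^ (b a i))

module Submission where

-- Put T k = 3^k x₀ + B_k.  Along the orbit T k = 2^(b_k) x_k, and the
-- recursion B_(k+1) = 3 B_k + 2^(b_k) gives T (k+1) · 3x_k = 3 T k · (3x_k + 1).  Telescoping,
--     (B_n + 3^n x₀) / (3^n x₀)  =  ∏_(j<n) (3x_j + 1) / (3x_j).
-- Each x_j is prime to 3 and 3x_j + 1 is even, so the quotients y_j = ⌊x_j / 3⌋ are pairwise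
-- distinct, and 3x_j ≥ 9y_j + 3 bounds the j-th factor by (9y_j + 4)/(9y_j + 3).  This ratio
-- decreases in y_j, so for distinct y_j (sorting them) the product is at most the product F/G
-- of (9m + 4)/(9m + 3) over m < n.  Finally (F/G)^9 ≤ (4/3)^9 (9n − 1)/8, since pairing
-- factors symmetrically around u gives (1 + 1/u)^(2k+1) ≤ (u + k + 1)/(u − k), which
-- telescopes along m; hence 2^9 F^9 < 3^9 n G^9, i.e. F/G < 1.5 n^(1/9).

open import Defs
open import Data.Nat
  using (ℕ; zero; suc; _+_; _*_; _∸_; _^_; _≤_; _<_; _>_; _≥_; z≤n; s≤s; s≤s⁻¹; z<s; NonZero; >-nonZero)
open import Data.Nat.Properties
open import Data.Nat.Divisibility
  using (_∣_; divides; _∣0; ∣m+n∣m⇒∣n; ∣1⇒≡1; m∣m*n; ∣m⇒∣m*n; ∣n⇒∣m*n; m%n≡0⇒n∣m)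
open import Data.Nat.DivMod using (_/_; _%_; m≡m%n+[m/n]*n; m%n<n)
open import Data.Nat.ListAction using (product)
open import Data.Nat.ListAction.Properties using (product-↭)
open import Data.Nat.Tactic.RingSolver using (solve-∀)
open import Data.Unit using (tt)
open import Data.Empty using (⊥-elim)
open import Data.Sum using (_⊎_; inj₁; inj₂)
open import Data.Product using (_,_)
open import Data.List using (List; _∷_; map; length; applyDownFrom; downFrom)
open import Data.List.Properties using (map-applyDownFrom; length-applyDownFrom)
open import Data.List.Relation.Unary.All using ([]; _∷_)
open import Data.List.Relation.Unary.AllPairs using ([]; _∷_)
open import Data.List.Relation.Unary.Linked using (Linked; []; [-]; _∷_)
open import Data.List.Relation.Unary.Unique.Propositional using (Unique)
open import Data.List.Relation.Unary.Unique.Propositional.Properties using (applyDownFrom⁺₁)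
open import Data.List.Relation.Binary.Pointwise as Pointwise using (Pointwise; []; _∷_)
open import Data.List.Relation.Binary.Permutation.Propositional using (_↭_; ↭-sym; ↭⇒↭ₛ)
open import Data.List.Relation.Binary.Permutation.Propositional.Properties using (↭-length; map⁺)
import Data.List.Relation.Binary.Permutation.Setoid.Properties as PermutationSetoid
open import Relation.Binary.Properties.DecTotalOrder ≤-decTotalOrder using (≥-decTotalOrder)
open import Data.List.Sort ≥-decTotalOrder using (sort; sort-↭; sort-↗)
open import Relation.Binary.PropositionalEquality
  using (_≡_; _≢_; refl; sym; trans; cong; cong₂; subst; subst₂; setoid; module ≡-Reasoning)
open import Relation.Nullary using (¬_)

∏< : ℕ → (ℕ → ℕ) → ℕ
∏< n f = product (applyDownFrom f n)

∏<-pos : ∀ n f → (∀ j → j < n → 0 < f j) → 0 < ∏< n f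
∏<-pos zero    f pos = z<s
∏<-pos (suc n) f pos = *-mono-< (pos n (n<1+n n)) (∏<-pos n f (λ j j<n → pos j (m<n⇒m<1+n j<n)))

∏<-cross : ∀ n p q r s → (∀ j → j < n → p j * q j ≤ r j * s j) → ∏< n p * ∏< n q ≤ ∏< n r * ∏< n s
∏<-cross zero    p q r s le = ≤-refl
∏<-cross (suc n) p q r s le =
  subst₂ _≤_ ([m*n]*[o*p]≡[m*o]*[n*p] (p n) (q n) _ _) ([m*n]*[o*p]≡[m*o]*[n*p] (r n) (s n) _ _)
    (*-mono-≤ (le n (n<1+n n)) (∏<-cross n p q r s (λ j j<n → le j (m<n⇒m<1+n j<n))))

^-distribʳ-* : ∀ m n k → (m * n) ^ k ≡ m ^ k * n ^ k
^-distribʳ-* m n zero    = refl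
^-distribʳ-* m n (suc k) = trans (cong (m * n *_) (^-distribʳ-* m n k)) ([m*n]*[o*p]≡[m*o]*[n*p] m n _ _)

crossProduct : ∀ (f g : ℕ → ℕ) {ms zs} → Pointwise (λ m z → f z * g m ≤ g z * f m) ms zs →
  product (map f zs) * product (map g ms) ≤ product (map g zs) * product (map f ms)
crossProduct f g []                            = ≤-refl
crossProduct f g {m ∷ ms} {z ∷ zs} (le ∷ les) =
  subst₂ _≤_ ([m*n]*[o*p]≡[m*o]*[n*p] (f z) (g m) _ _) ([m*n]*[o*p]≡[m*o]*[n*p] (g z) (f m) _ _)
    (*-mono-≤ le (crossProduct f g les))

decreasing⇒aboveDownFrom : ∀ {ws : List ℕ} → Linked _≥_ ws → Unique ws → Pointwise _≤_ (downFrom (length ws)) ws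
decreasing⇒aboveDownFrom []           []                 = []
decreasing⇒aboveDownFrom [-]          _                  = z≤n ∷ []
decreasing⇒aboveDownFrom (w≥w' ∷ dec) ((w≢w' ∷ _) ∷ uniq) with decreasing⇒aboveDownFrom dec uniq
... | above@(len≤w' ∷ _) = ≤-trans (s≤s len≤w') (≤∧≢⇒< w≥w' (λ w'≡w → w≢w' (sym w'≡w))) ∷ above

-- For a decreasing ratio f/g, the product of f z / g z over distinct z is at most the
-- product over the smallest possible indices 0, …, |zs|-1 (sort zs decreasingly).
distinctRatioBound : ∀ (f g : ℕ → ℕ) → (∀ {m z} → m ≤ z → f z * g m ≤ g z * f m) →
  ∀ {zs} → Unique zs → product (map f zs) * ∏< (length zs) g ≤ product (map g zs) * ∏< (length zs) f
distinctRatioBound f g decreasing {zs} unique =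
  subst₂ _≤_ (cong₂ _*_ (sameProduct f) (sameRange g)) (cong₂ _*_ (sameProduct g) (sameRange f))
    (crossProduct f g (Pointwise.map decreasing (decreasing⇒aboveDownFrom (sort-↗ zs) sortedUnique)))
  where
  sorted↭zs : sort zs ↭ zs
  sorted↭zs = sort-↭ zs
  sortedUnique : Unique (sort zs)
  sortedUnique = PermutationSetoid.Unique-resp-↭ (setoid ℕ) (↭⇒↭ₛ (↭-sym sorted↭zs)) unique
  sameProduct : ∀ h → product (map h (sort zs)) ≡ product (map h zs)
  sameProduct h = product-↭ (map⁺ h sorted↭zs)
  sameRange : ∀ h → product (map h (downFrom (length (sort zs)))) ≡ ∏< (length zs) h
  sameRange h = trans (cong (λ k → product (map h (downFrom k))) (↭-length sorted↭zs))
                      (cong product (map-applyDownFrom (λ k → k) h (length zs)))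

-- The pairing inequality (1 + 1/(u-i)) (1 + 1/(u+i)) ≥ (1 + 1/u)², written with u = s + i.
pairing : ∀ s i → (s + i + 1) * (s + i + 1) * (s * (s + 2 * i)) ≤ (s + i) * (s + i) * ((s + 1) * (s + 2 * i + 1))
pairing s i = ≤-trans (m≤m+n _ _) (≤-reflexive (identity s i))
  where
  identity : ∀ s i → (s + i + 1) * (s + i + 1) * (s * (s + 2 * i)) + i * i * (2 * (s + i) + 1)
                     ≡ (s + i) * (s + i) * ((s + 1) * (s + 2 * i + 1))
  identity = solve-∀

-- Pairing the 2k+1 factors u-k, …, u+k symmetrically and telescoping:
-- (1 + 1/u)^(2k+1) ≤ (u + k + 1)/(u - k), written with u = s + k.
oddPowerBound : ∀ k s → (s + k + 1) ^ (1 + 2 * k) * s ≤ (s + k) ^ (1 + 2 * k) * (s + 2 * k + 1)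
oddPowerBound zero s = ≤-reflexive (identity s)
  where
  identity : ∀ s → (s + 0 + 1) * 1 * s ≡ (s + 0) * 1 * (s + 0 + 1)
  identity = solve-∀
-- Step: multiply the bound for k at s + 1 (same u) by the pairing with i = k + 1, then
-- cancel the common factor (s + 1)(s + 2k + 2).
oddPowerBound (suc k) s = *-cancelʳ-≤ _ _ Q {{Q≢0}} (begin
    A ^ (1 + 2 * suc k) * s * Q               ≡⟨ cong (λ P → P * s * Q) (pow-odd-suc A k) ⟩
    A ^ (1 + 2 * k) * (A * A) * s * Q         ≡⟨ regroupˡ (A ^ (1 + 2 * k)) A s t ⟩
    A ^ (1 + 2 * k) * (s + 1) * (A * A * (s * t))
      ≤⟨ *-mono-≤ shiftedIH (pairing s (suc k)) ⟩
    a ^ (1 + 2 * k) * t * (a * a * ((s + 1) * (t + 1))) ≡⟨ regroupʳ (a ^ (1 + 2 * k)) a s t ⟩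
    a ^ (1 + 2 * k) * (a * a) * (t + 1) * Q   ≡⟨ cong (λ P → P * (t + 1) * Q) (sym (pow-odd-suc a k)) ⟩
    a ^ (1 + 2 * suc k) * (t + 1) * Q         ∎)
  where
  open ≤-Reasoning
  A = s + suc k + 1
  a = s + suc k
  t = s + 2 * suc k
  Q = (s + 1) * t
  Q≢0 : NonZero Q
  Q≢0 = >-nonZero (*-mono-< (m≤n+m 1 s) (≤-trans (s≤s z≤n) (m≤n+m (2 * suc k) s)))
  pow-odd-suc : ∀ x k → x ^ (1 + 2 * suc k) ≡ x ^ (1 + 2 * k) * (x * x)
  pow-odd-suc x k = trans (cong (λ e → x ^ (1 + e)) (*-suc 2 k)) (comm (x ^ (1 + 2 * k)) x)
    where
    comm : ∀ P x → x * (x * P) ≡ P * (x * x)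
    comm = solve-∀
  regroupˡ : ∀ P A s t → P * (A * A) * s * ((s + 1) * t) ≡ P * (s + 1) * (A * A * (s * t))
  regroupˡ = solve-∀
  regroupʳ : ∀ P a s t → P * t * (a * a * ((s + 1) * (t + 1))) ≡ P * (a * a) * (t + 1) * ((s + 1) * t)
  regroupʳ = solve-∀
  shiftedIH : A ^ (1 + 2 * k) * (s + 1) ≤ a ^ (1 + 2 * k) * t
  shiftedIH = subst₂ _≤_ (cong (λ B → B ^ (1 + 2 * k) * (s + 1)) (e1 s k))
                         (cong₂ (λ c d → c ^ (1 + 2 * k) * d) (e2 s k) (e3 s k))
                         (oddPowerBound k (s + 1))
    where
    e1 : ∀ s k → s + 1 + k + 1 ≡ s + suc k + 1
    e1 = solve-∀
    e2 : ∀ s k → s + 1 + k ≡ s + suc k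
    e2 = solve-∀
    e3 : ∀ s k → s + 1 + 2 * k + 1 ≡ s + 2 * suc k
    e3 = solve-∀

-- The case k = 4 at u = 9t + 12, the step of the product estimate below.
ninthPowerStep : ∀ t → (9 * t + 13) ^ 9 * (9 * t + 8) ≤ (9 * t + 12) ^ 9 * (9 * t + 17)
ninthPowerStep t = subst₂ _≤_ (cong (λ c → c ^ 9 * (9 * t + 8)) (e13 t))
                              (cong₂ (λ c d → c ^ 9 * d) (e12 t) (e17 t))
                              (oddPowerBound 4 (9 * t + 8))
  where
  e13 : ∀ t → 9 * t + 8 + 4 + 1 ≡ 9 * t + 13
  e13 = solve-∀
  e12 : ∀ t → 9 * t + 8 + 4 ≡ 9 * t + 12
  e12 = solve-∀
  e17 : ∀ t → 9 * t + 8 + 2 * 4 + 1 ≡ 9 * t + 17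
  e17 = solve-∀

F G : ℕ → ℕ
F n = ∏< n (λ m → 9 * m + 4)
G n = ∏< n (λ m → 9 * m + 3)

0<9v+3 : ∀ v → 0 < 9 * v + 3
0<9v+3 v = ≤-trans (s≤s z≤n) (m≤n+m 3 (9 * v))

ratioDecreasing : ∀ {m z} → m ≤ z → (9 * z + 4) * (9 * m + 3) ≤ (9 * z + 3) * (9 * m + 4)
ratioDecreasing {m} m≤z with m≤n⇒∃[o]m+o≡n m≤z
... | d , refl = ≤-trans (m≤m+n _ (9 * d)) (≤-reflexive (identity m d))
  where
  identity : ∀ m d → (9 * (m + d) + 4) * (9 * m + 3) + 9 * d ≡ (9 * (m + d) + 3) * (9 * m + 4)
  identity = solve-∀

distinctValuesBound : ∀ n (y : ℕ → ℕ) → (∀ {i j} → j < i → i < n → y i ≢ y j) →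
  ∏< n (λ j → 9 * y j + 4) * G n ≤ ∏< n (λ j → 9 * y j + 3) * F n
distinctValuesBound n y distinct =
  subst₂ _≤_ (cong₂ _*_ (valuesProduct (λ v → 9 * v + 4)) (cong G count))
             (cong₂ _*_ (valuesProduct (λ v → 9 * v + 3)) (cong F count))
    (distinctRatioBound (λ v → 9 * v + 4) (λ v → 9 * v + 3) ratioDecreasing (applyDownFrom⁺₁ y n distinct))
  where
  valuesProduct : ∀ h → product (map h (applyDownFrom y n)) ≡ ∏< n (λ j → h (y j))
  valuesProduct h = cong product (map-applyDownFrom y h n)
  count : length (applyDownFrom y n) ≡ n
  count = length-applyDownFrom y n

productBound : ∀ t → F (suc t) ^ 9 * (8 * 3 ^ 9) ≤ G (suc t) ^ 9 * (9 * t + 8) * 4 ^ 9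
productBound zero = ≤-refl
productBound (suc t) = begin
  F (suc (suc t)) ^ 9 * (8 * 3 ^ 9)          ≡⟨ cong (λ c → (c * f) ^ 9 * (8 * 3 ^ 9)) (f-shift t) ⟩
  ((9 * t + 13) * f) ^ 9 * (8 * 3 ^ 9)        ≡⟨ cong (_* (8 * 3 ^ 9)) (^-distribʳ-* (9 * t + 13) f 9) ⟩
  (9 * t + 13) ^ 9 * f ^ 9 * (8 * 3 ^ 9)      ≡⟨ regroupˡ ((9 * t + 13) ^ 9) (f ^ 9) (8 * 3 ^ 9) ⟩
  f ^ 9 * (8 * 3 ^ 9) * (9 * t + 13) ^ 9      ≤⟨ *-monoˡ-≤ ((9 * t + 13) ^ 9) (productBound t) ⟩
  g ^ 9 * (9 * t + 8) * 4 ^ 9 * (9 * t + 13) ^ 9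
    ≡⟨ regroupᵐ (g ^ 9) (9 * t + 8) (4 ^ 9) ((9 * t + 13) ^ 9) ⟩
  g ^ 9 * 4 ^ 9 * ((9 * t + 13) ^ 9 * (9 * t + 8))  ≤⟨ *-monoʳ-≤ (g ^ 9 * 4 ^ 9) (ninthPowerStep t) ⟩
  g ^ 9 * 4 ^ 9 * ((9 * t + 12) ^ 9 * (9 * t + 17))
    ≡⟨ regroupʳ (g ^ 9) (4 ^ 9) ((9 * t + 12) ^ 9) (9 * t + 17) ⟩
  (9 * t + 12) ^ 9 * g ^ 9 * (9 * t + 17) * 4 ^ 9
    ≡⟨ cong₂ (λ c d → c * d * 4 ^ 9) (sym (^-distribʳ-* (9 * t + 12) g 9)) (e17 t) ⟩
  ((9 * t + 12) * g) ^ 9 * (9 * suc t + 8) * 4 ^ 9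
    ≡⟨ cong (λ c → (c * g) ^ 9 * (9 * suc t + 8) * 4 ^ 9) (g-shift t) ⟩
  G (suc (suc t)) ^ 9 * (9 * suc t + 8) * 4 ^ 9 ∎
  where
  open ≤-Reasoning
  f = F (suc t)
  g = G (suc t)
  f-shift : ∀ t → 9 * suc t + 4 ≡ 9 * t + 13
  f-shift = solve-∀
  g-shift : ∀ t → 9 * t + 12 ≡ 9 * suc t + 3
  g-shift = solve-∀
  e17 : ∀ t → 9 * t + 17 ≡ 9 * suc t + 8
  e17 = solve-∀
  regroupˡ : ∀ x y c → x * y * c ≡ y * c * x
  regroupˡ = solve-∀
  regroupᵐ : ∀ g d c x → g * d * c * x ≡ g * c * (x * d)
  regroupᵐ = solve-∀
  regroupʳ : ∀ g c x d → g * c * (x * d) ≡ x * g * d * c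
  regroupʳ = solve-∀

-- The linear inequality 2^27 (9n - 1) < 8 · 3^18 · n behind the constant 1.5.
linearBound : ∀ t → (9 * t + 8) * (4 ^ 9 * 2 ^ 9) < (t + 1) * (3 ^ 9 * (8 * 3 ^ 9))
linearBound t = begin-strict
  (9 * t + 8) * (4 ^ 9 * 2 ^ 9)            ≡⟨ spreadˡ t (4 ^ 9 * 2 ^ 9) ⟩
  t * (9 * (4 ^ 9 * 2 ^ 9)) + 8 * (4 ^ 9 * 2 ^ 9)
    <⟨ +-mono-≤-< (*-monoʳ-≤ t (≤ᵇ⇒≤ _ _ tt)) (≤ᵇ⇒≤ _ _ tt) ⟩
  t * (3 ^ 9 * (8 * 3 ^ 9)) + 3 ^ 9 * (8 * 3 ^ 9) ≡⟨ spreadʳ t (3 ^ 9 * (8 * 3 ^ 9)) ⟩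
  (t + 1) * (3 ^ 9 * (8 * 3 ^ 9))         ∎
  where
  open ≤-Reasoning
  spreadˡ : ∀ t c → (9 * t + 8) * c ≡ t * (9 * c) + 8 * c
  spreadˡ = solve-∀
  spreadʳ : ∀ t c → t * c + c ≡ (t + 1) * c
  spreadʳ = solve-∀

numericBound : ∀ t → F (suc t) ^ 9 * 2 ^ 9 < G (suc t) ^ 9 * suc t * 3 ^ 9
numericBound t = *-cancelʳ-< (8 * 3 ^ 9) _ _ (begin-strict
  F (suc t) ^ 9 * 2 ^ 9 * (8 * 3 ^ 9)       ≡⟨ swapʳ (F (suc t) ^ 9) (2 ^ 9) (8 * 3 ^ 9) ⟩
  F (suc t) ^ 9 * (8 * 3 ^ 9) * 2 ^ 9       ≤⟨ *-monoˡ-≤ (2 ^ 9) (productBound t) ⟩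
  g9 * (9 * t + 8) * 4 ^ 9 * 2 ^ 9          ≡⟨ assoc₃ g9 (9 * t + 8) (4 ^ 9) (2 ^ 9) ⟩
  g9 * ((9 * t + 8) * (4 ^ 9 * 2 ^ 9))      <⟨ *-monoʳ-< g9 {{g9≢0}} (linearBound t) ⟩
  g9 * ((t + 1) * (3 ^ 9 * (8 * 3 ^ 9)))    ≡⟨ unshift g9 t (3 ^ 9) (8 * 3 ^ 9) ⟩
  g9 * suc t * 3 ^ 9 * (8 * 3 ^ 9)          ∎)
  where
  open ≤-Reasoning
  g9 = G (suc t) ^ 9
  g9≢0 : NonZero g9
  g9≢0 = m^n≢0 (G (suc t)) 9 {{>-nonZero (∏<-pos (suc t) _ (λ j _ → 0<9v+3 j))}}
  swapʳ : ∀ x y z → x * y * z ≡ x * z * y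
  swapʳ = solve-∀
  assoc₃ : ∀ g a b c → g * a * b * c ≡ g * (a * (b * c))
  assoc₃ = solve-∀
  unshift : ∀ g t a b → g * ((t + 1) * (a * b)) ≡ g * suc t * a * b
  unshift = solve-∀

mediant : ∀ {u g} → g ≤ u → (u + 1) * g ≤ u * (g + 1)
mediant {g = g} g≤u with m≤n⇒∃[o]m+o≡n g≤u
... | d , refl = ≤-trans (m≤m+n _ d) (≤-reflexive (identity g d))
  where
  identity : ∀ g d → (g + d + 1) * g + d ≡ (g + d) * (g + 1)
  identity = solve-∀

residue12 : ∀ x → ¬ 3 ∣ x → x ≡ 1 + x / 3 * 3 ⊎ x ≡ 2 + x / 3 * 3
residue12 x 3∤x with x % 3 | m≡m%n+[m/n]*n x 3 | m%n<n x 3 | m%n≡0⇒n∣m x 3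
... | 0                 | _ | _                        | 3∣x = ⊥-elim (3∤x (3∣x refl))
... | 1                 | e | _                        | _   = inj₁ e
... | 2                 | e | _                        | _   = inj₂ e
... | suc (suc (suc _)) | _ | s≤s (s≤s (s≤s ()))      | _

factorBound : ∀ x → ¬ 3 ∣ x → (3 * x + 1) * (9 * (x / 3) + 3) ≤ 3 * x * (9 * (x / 3) + 4)
factorBound x 3∤x = subst (λ c → (3 * x + 1) * (9 * (x / 3) + 3) ≤ 3 * x * c) (+-assoc (9 * (x / 3)) 3 1)
  (mediant {u = 3 * x} (≤-trans (≤-reflexive (scale (x / 3))) (*-monoʳ-≤ 3 thirdBelow)))
  where
  scale : ∀ q → 9 * q + 3 ≡ 3 * (1 + q * 3)
  scale = solve-∀
  thirdBelow : 1 + x / 3 * 3 ≤ x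
  thirdBelow with residue12 x 3∤x
  ... | inj₁ e = ≤-reflexive (sym e)
  ... | inj₂ e = ≤-trans (n≤1+n _) (≤-reflexive (sym e))

3∤x⇒x>0 : ∀ {x} → ¬ 3 ∣ x → 0 < x
3∤x⇒x>0 3∤x = n≢0⇒n>0 (λ x≡0 → 3∤x (subst (3 ∣_) (sym x≡0) (3 ∣0)))

3∤3y+1 : ∀ y → ¬ 3 ∣ 3 * y + 1
3∤3y+1 y 3∣3y+1 with ∣1⇒≡1 (∣m+n∣m⇒∣n 3∣3y+1 (m∣m*n y))
... | ()

-- 3x + 1 and 3(x + 1) + 1 differ by 3, so they cannot both be even.
consecutiveNotBothEven : ∀ x → 2 ∣ 3 * x + 1 → ¬ 2 ∣ 3 * suc x + 1
consecutiveNotBothEven x 2∣3x+1 2∣3x+4 = 2∤3 (∣m+n∣m⇒∣n (subst (2 ∣_) (shift x) 2∣3x+4) 2∣3x+1)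
  where
  shift : ∀ x → 3 * suc x + 1 ≡ 3 * x + 1 + 3
  shift = solve-∀
  2∤3 : ¬ 2 ∣ 3
  2∤3 (divides (suc (suc q)) ())

nextResidue : ∀ {x x' q q'} → x ≡ 1 + q * 3 → x' ≡ 2 + q' * 3 → q ≡ q' → x' ≡ suc x
nextResidue x≡3q+1 x'≡3q+2 refl = trans x'≡3q+2 (cong suc (sym x≡3q+1))

sameThird : ∀ x x' → ¬ 3 ∣ x → ¬ 3 ∣ x' → 2 ∣ 3 * x + 1 → 2 ∣ 3 * x' + 1 → x / 3 ≡ x' / 3 → x ≡ x'
sameThird x x' 3∤x 3∤x' even even' q≡q' with residue12 x 3∤x | residue12 x' 3∤x'
... | inj₁ e | inj₁ e' = trans e (trans (cong (λ q → 1 + q * 3) q≡q') (sym e'))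
... | inj₂ e | inj₂ e' = trans e (trans (cong (λ q → 2 + q * 3) q≡q') (sym e'))
... | inj₁ e | inj₂ e' = ⊥-elim (consecutiveNotBothEven x even
                           (subst (λ z → 2 ∣ 3 * z + 1) (nextResidue e e' q≡q') even'))
... | inj₂ e | inj₁ e' = ⊥-elim (consecutiveNotBothEven x' even'
                           (subst (λ z → 2 ∣ 3 * z + 1) (nextResidue e' e (sym q≡q')) even))

evenOf : ∀ {c X v} → 1 ≤ c → 2 ^ c * X ≡ v → 2 ∣ v
evenOf {suc c} {X} _ refl = ∣m⇒∣m*n X (m∣m*n (2 ^ c))

sumBelow-cong : ∀ k f g → (∀ i → i < k → f i ≡ g i) → sumBelow k f ≡ sumBelow k g
sumBelow-cong zero    f g f≗g = refl
sumBelow-cong (suc k) f g f≗g =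
  cong₂ _+_ (sumBelow-cong k f g (λ i i<k → f≗g i (m<n⇒m<1+n i<k))) (f≗g k (n<1+n k))

sumBelow-scale : ∀ k c f → sumBelow k (λ i → c * f i) ≡ c * sumBelow k f
sumBelow-scale zero    c f = sym (*-zeroʳ c)
sumBelow-scale (suc k) c f = trans (cong (_+ c * f k) (sumBelow-scale k c f)) (sym (*-distribˡ-+ c _ _))

B-step : ∀ a k → B a (suc k) ≡ 3 * B a k + 2 ^ b a k
B-step a k = cong₂ _+_ earlierTerms lastTerm
  where
  exponent : ∀ i → i < k → k ∸ i ≡ suc (k ∸ 1 ∸ i)
  exponent i (s≤s i≤k-1) = +-∸-assoc 1 i≤k-1
  earlierTerms : sumBelow k (λ i → 3 ^ (k ∸ i) * 2 ^ b a i) ≡ 3 * B a k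
  earlierTerms = trans
    (sumBelow-cong k _ _ (λ i i<k → trans (cong (λ e → 3 ^ e * 2 ^ b a i) (exponent i i<k))
                                          (*-assoc 3 (3 ^ (k ∸ 1 ∸ i)) (2 ^ b a i))))
    (sumBelow-scale k 3 (λ i → 3 ^ (k ∸ 1 ∸ i) * 2 ^ b a i))
  lastTerm : 3 ^ (k ∸ k) * 2 ^ b a k ≡ 2 ^ b a k
  lastTerm = trans (cong (λ e → 3 ^ e * 2 ^ b a k) (n∸n≡0 k)) (*-identityˡ _)

telescope : ∀ c (T u v : ℕ → ℕ) n → (∀ k → k < n → T (suc k) * u k ≡ c * T k * v k) →
  T n * ∏< n u ≡ c ^ n * T 0 * ∏< n v
telescope c T u v zero    step = cong (_* 1) (sym (*-identityˡ (T 0)))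
telescope c T u v (suc n) step = begin
  T (suc n) * (u n * U)       ≡⟨ sym (*-assoc (T (suc n)) (u n) U) ⟩
  T (suc n) * u n * U         ≡⟨ cong (_* U) (step n (n<1+n n)) ⟩
  c * T n * v n * U           ≡⟨ regroupˡ c (T n) (v n) U ⟩
  c * v n * (T n * U)         ≡⟨ cong (c * v n *_) (telescope c T u v n (λ k k<n → step k (m<n⇒m<1+n k<n))) ⟩
  c * v n * (c ^ n * T 0 * V) ≡⟨ regroupʳ c (v n) (c ^ n) (T 0) V ⟩
  c * c ^ n * T 0 * (v n * V) ∎
  where
  open ≡-Reasoning
  U = ∏< n u
  V = ∏< n v
  regroupˡ : ∀ c t w U → c * t * w * U ≡ c * w * (t * U)
  regroupˡ = solve-∀
  regroupʳ : ∀ c w p t V → c * w * (p * t * V) ≡ c * p * t * (w * V)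
  regroupʳ = solve-∀

ratioChain : ∀ {t z u v f' g' f g} → t * u ≡ z * v → v * g' ≤ u * f' → f' * g ≤ g' * f →
  0 < u → 0 < g' → t * g ≤ z * f
ratioChain {t} {z} {u} {v} {f'} {g'} {f} {g} tu≡zv pointwise extremal 0<u 0<g' =
  *-cancelʳ-≤ (t * g) (z * f) (u * g') {{>-nonZero (*-mono-< 0<u 0<g')}} (begin
    t * g * (u * g')    ≡⟨ regroup₁ t g u g' ⟩
    t * u * (g * g')    ≡⟨ cong (_* (g * g')) tu≡zv ⟩
    z * v * (g * g')    ≡⟨ regroup₂ z v g g' ⟩
    z * g * (v * g')    ≤⟨ *-monoʳ-≤ (z * g) pointwise ⟩
    z * g * (u * f')    ≡⟨ regroup₂ z g u f' ⟩
    z * u * (g * f')    ≡⟨ cong (λ w → z * u * w) (*-comm g f') ⟩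
    z * u * (f' * g)    ≤⟨ *-monoʳ-≤ (z * u) extremal ⟩
    z * u * (g' * f)    ≡⟨ regroup₃ z u g' f ⟩
    z * f * (u * g')    ∎)
  where
  open ≤-Reasoning
  regroup₁ : ∀ t g u g' → t * g * (u * g') ≡ t * u * (g * g')
  regroup₁ = solve-∀
  regroup₂ : ∀ z v g g' → z * v * (g * g') ≡ z * g * (v * g')
  regroup₂ = solve-∀
  regroup₃ : ∀ z u g' f → z * u * (g' * f) ≡ z * f * (u * g')
  regroup₃ = solve-∀

powerChain : ∀ k c d {t z f g n} → t * g ≤ z * f → f ^ k * c ^ k < g ^ k * n * d ^ k → 0 < z →
  (c * t) ^ k < n * (d * z) ^ k
powerChain k c d {t} {z} {f} {g} {n} ratio numeric 0<z = *-cancelʳ-< (g ^ k) _ _ (begin-strict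
  (c * t) ^ k * g ^ k              ≡⟨ sym (^-distribʳ-* (c * t) g k) ⟩
  (c * t * g) ^ k                  ≡⟨ cong (_^ k) (*-assoc c t g) ⟩
  (c * (t * g)) ^ k                ≤⟨ ^-monoˡ-≤ k (*-monoʳ-≤ c ratio) ⟩
  (c * (z * f)) ^ k                ≡⟨ trans (^-distribʳ-* c (z * f) k) (cong (c ^ k *_) (^-distribʳ-* z f k)) ⟩
  c ^ k * (z ^ k * f ^ k)          ≡⟨ regroupˡ (c ^ k) (z ^ k) (f ^ k) ⟩
  z ^ k * (f ^ k * c ^ k)          <⟨ *-monoʳ-< (z ^ k) {{m^n≢0 z k {{>-nonZero 0<z}}}} numeric ⟩
  z ^ k * (g ^ k * n * d ^ k)      ≡⟨ regroupʳ (z ^ k) (g ^ k) n (d ^ k) ⟩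
  n * (d ^ k * z ^ k) * g ^ k      ≡⟨ cong (λ w → n * w * g ^ k) (sym (^-distribʳ-* d z k)) ⟩
  n * (d * z) ^ k * g ^ k          ∎)
  where
  open ≤-Reasoning
  regroupˡ : ∀ c z f → c * (z * f) ≡ z * (f * c)
  regroupˡ = solve-∀
  regroupʳ : ∀ z g n d → z * (g * n * d) ≡ n * (d * z) * g
  regroupʳ = solve-∀

module Orbit (a x : ℕ → ℕ) (p : ℕ)
  (orbit : ∀ k → 1 ≤ k → k ≤ p → 2 ^ a k * x k ≡ 3 * x (k ∸ 1) + 1) where

  T : ℕ → ℕ
  T k = 3 ^ k * x 0 + B a k

  T-zero : T 0 ≡ x 0
  T-zero = trans (+-identityʳ _) (+-identityʳ _)

  T-step : ∀ k → T (suc k) ≡ 3 * T k + 2 ^ b a k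
  T-step k = trans (cong (3 ^ suc k * x 0 +_) (B-step a k)) (regroup (3 ^ k) (x 0) (B a k) (2 ^ b a k))
    where
    regroup : ∀ t y c q → 3 * t * y + (3 * c + q) ≡ 3 * (t * y + c) + q
    regroup = solve-∀

  pow-b-suc : ∀ k X → 2 ^ b a (suc k) * X ≡ 2 ^ b a k * (2 ^ a (suc k) * X)
  pow-b-suc k X = trans (cong (_* X) (^-distribˡ-+-* 2 (b a k) (a (suc k)))) (*-assoc (2 ^ b a k) _ X)

  T-suc-closed : ∀ k → T k ≡ 2 ^ b a k * x k → T (suc k) ≡ 2 ^ b a k * (3 * x k + 1)
  T-suc-closed k closed = begin
    T (suc k)                             ≡⟨ T-step k ⟩
    3 * T k + 2 ^ b a k                   ≡⟨ cong (λ t → 3 * t + 2 ^ b a k) closed ⟩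
    3 * (2 ^ b a k * x k) + 2 ^ b a k     ≡⟨ factor (2 ^ b a k) (x k) ⟩
    2 ^ b a k * (3 * x k + 1)             ∎
    where
    open ≡-Reasoning
    factor : ∀ P y → 3 * (P * y) + P ≡ P * (3 * y + 1)
    factor = solve-∀

  T-closed : ∀ k → k ≤ p → T k ≡ 2 ^ b a k * x k
  T-closed zero    _    = +-identityʳ _
  T-closed (suc k) k<p = begin
    T (suc k)                             ≡⟨ T-suc-closed k (T-closed k (<⇒≤ k<p)) ⟩
    2 ^ b a k * (3 * x k + 1)             ≡⟨ cong (2 ^ b a k *_) (sym (orbit (suc k) (s≤s z≤n) k<p)) ⟩
    2 ^ b a k * (2 ^ a (suc k) * x (suc k)) ≡⟨ sym (pow-b-suc k (x (suc k))) ⟩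
    2 ^ b a (suc k) * x (suc k)           ∎
    where open ≡-Reasoning

  T-ratio : ∀ k → k ≤ p → T (suc k) * (3 * x k) ≡ 3 * T k * (3 * x k + 1)
  T-ratio k k≤p = begin
    T (suc k) * (3 * x k)                       ≡⟨ cong (_* (3 * x k)) (T-suc-closed k (T-closed k k≤p)) ⟩
    2 ^ b a k * (3 * x k + 1) * (3 * x k)       ≡⟨ regroup (2 ^ b a k) (x k) ⟩
    3 * (2 ^ b a k * x k) * (3 * x k + 1)       ≡⟨ cong (λ t → 3 * t * (3 * x k + 1)) (sym (T-closed k k≤p)) ⟩
    3 * T k * (3 * x k + 1)                     ∎
    where
    open ≡-Reasoning
    regroup : ∀ P y → P * (3 * y + 1) * (3 * y) ≡ 3 * (P * y) * (3 * y + 1)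
    regroup = solve-∀

  -- The step after x_p, taken by the final value X = x_(p+1).
  lastStep : ∀ X → 2 ^ b a (suc p) * X ≡ T (suc p) → 2 ^ a (suc p) * X ≡ 3 * x p + 1
  lastStep X final = *-cancelˡ-≡ _ _ (2 ^ b a p) {{m^n≢0 2 (b a p)}}
    (trans (sym (pow-b-suc p X)) (trans final (T-suc-closed p (T-closed p ≤-refl))))

  -- If 3 ∤ x₀ then 3 ∤ x_k, since 3 divides 2^a x_k = 3x_(k-1) + 1 otherwise.
  coprimeTo3 : ¬ 3 ∣ x 0 → ∀ k → k ≤ p → ¬ 3 ∣ x k
  coprimeTo3 3∤x₀ zero    _   = 3∤x₀
  coprimeTo3 3∤x₀ (suc k) k<p 3∣x =
    3∤3y+1 (x k) (subst (3 ∣_) (orbit (suc k) (s≤s z≤n) k<p) (∣n⇒∣m*n (2 ^ a (suc k)) 3∣x))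

  third : ℕ → ℕ
  third j = x j / 3

  orbitProduct : T (suc p) * ∏< (suc p) (λ j → 3 * x j) ≡ 3 ^ suc p * x 0 * ∏< (suc p) (λ j → 3 * x j + 1)
  orbitProduct = trans (telescope 3 T _ _ (suc p) (λ k k<n → T-ratio k (s≤s⁻¹ k<n)))
                       (cong (λ t → 3 ^ suc p * t * ∏< (suc p) (λ j → 3 * x j + 1)) T-zero)

  module _ (3∤x₀ : ¬ 3 ∣ x 0) where

    orbitPositive : 0 < ∏< (suc p) (λ j → 3 * x j)
    orbitPositive = ∏<-pos (suc p) _ (λ j j<n → *-mono-< (s≤s (z≤n {2})) (3∤x⇒x>0 (coprimeTo3 3∤x₀ j (s≤s⁻¹ j<n))))

    factorsBound : ∏< (suc p) (λ j → 3 * x j + 1) * ∏< (suc p) (λ j → 9 * third j + 3)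
                 ≤ ∏< (suc p) (λ j → 3 * x j) * ∏< (suc p) (λ j → 9 * third j + 4)
    factorsBound = ∏<-cross (suc p) (λ j → 3 * x j + 1) (λ j → 9 * third j + 3) (λ j → 3 * x j) (λ j → 9 * third j + 4)
                     (λ j j<n → factorBound (x j) (coprimeTo3 3∤x₀ j (s≤s⁻¹ j<n)))

    -- Distinct orbit values have distinct thirds, as every 3x_j + 1 is even.
    thirdsDistinct : (∀ j → j ≤ p → 2 ∣ 3 * x j + 1) → (∀ i j → i < suc p → j < suc p → x i ≡ x j → i ≡ j) →
      ∀ {i j} → j < i → i < suc p → third i ≢ third j
    thirdsDistinct even distinct {i} {j} j<i i<n third≡ = <⇒≢ j<i (sym (distinct i j i<n j<n
      (sameThird (x i) (x j) (coprimeTo3 3∤x₀ i (s≤s⁻¹ i<n)) (coprimeTo3 3∤x₀ j (s≤s⁻¹ j<n))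
                 (even i (s≤s⁻¹ i<n)) (even j (s≤s⁻¹ j<n)) third≡)))
      where
      j<n : j < suc p
      j<n = <-trans j<i i<n

  -- 3x_j + 1 = 2^(a_(j+1)) x_(j+1) is even; for j = p the final value X plays x_(p+1).
  evenAlong : (∀ i → 1 ≤ i → 1 ≤ a i) → ∀ X → 2 ^ b a (suc p) * X ≡ T (suc p) → ∀ j → j ≤ p → 2 ∣ 3 * x j + 1
  evenAlong a≥1 X final j j≤p with m≤n⇒m<n∨m≡n j≤p
  ... | inj₁ j<p  = evenOf (a≥1 (suc j) (s≤s z≤n)) (orbit (suc j) (s≤s z≤n) j<p)
  ... | inj₂ refl = evenOf (a≥1 (suc p) (s≤s z≤n)) (lastStep X final)

theorem4p6 : (a : ℕ → ℕ) → (∀ i → 1 ≤ i → 1 ≤ a i) →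
    (n : ℕ) → 1 ≤ n →
    (x : ℕ → ℕ) → (xn : ℕ) →
    2 ^ b a n * xn ≡ 3 ^ n * x 0 + B a n →
    1 ≤ x 0 → x 0 < 2 ^ b a n →
    1 ≤ xn → xn < 3 ^ n →
    ¬ (3 ∣ x 0) →
    (∀ k → 1 ≤ k → k ≤ n ∸ 1 → 2 ^ a k * x k ≡ 3 * x (k ∸ 1) + 1) →
    (∀ i j → i < n → j < n → x i ≡ x j → i ≡ j) →
    n * (3 ^ (n + 1) * x 0) ^ 9 > (2 * (B a n + 3 ^ n * x 0)) ^ 9
theorem4p6 a a≥1 (suc p) _ x xn final x₀≥1 _ _ _ 3∤x₀ orbit distinct =
  subst₂ (λ s w → (2 * s) ^ 9 < n * w ^ 9) (+-comm Z (B a n)) threeZ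
    (powerChain 9 2 3 {T n} {Z} {F n} {G n} {n} ratio (numericBound p) (*-mono-< (m^n>0 3 n) x₀≥1))
  where
  open Orbit a x p orbit
  n = suc p
  Z = 3 ^ n * x 0
  ratio : T n * G n ≤ Z * F n
  ratio = ratioChain {t = T n} {z = Z} {v = ∏< n (λ j → 3 * x j + 1)} orbitProduct (factorsBound 3∤x₀)
    (distinctValuesBound n third (thirdsDistinct 3∤x₀ (evenAlong a≥1 xn final) distinct))
    (orbitPositive 3∤x₀) (∏<-pos n _ (λ j _ → 0<9v+3 (third j)))
  threeZ : 3 * Z ≡ 3 ^ (n + 1) * x 0
  threeZ = trans (sym (*-assoc 3 (3 ^ n) (x 0))) (cong (λ e → 3 ^ e * x 0) (+-comm 1 n))
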